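{- For every positive integer $n$, the set $\mathcal{N}(n)$ has exactly $n!$ elements, i.e. $|\mathcal{N}(n)|=n!$.
   Context: A network on $n$ points is a set $E$ of ordered pairs $(i,j)$ of integers with $1\le i<j\le n$ (the directed edges from $i$ to $j$; at most one edge from $i$ to $j$) such that no point is both the second coordinate of one edge and the first coordinate of another, i.e. there is no triple $i<j<k$ with $(i,j),(j,k)\in E$. (A point which is the first coordinate of some edge is a source, one which is the second coordinate of some edge is a sink, and a point on no edge is neutral.) $\mathcal{N}(n)$ denotes the set of networks on $n$ points satisfying condition (B1): whenever $(i,k),(j,l)\in E$ with $i<j<k<l$, also $(j,k)\in E$. -}

module Defs where

open import Data.Nat using (ℕ)
open import Data.Bool using (Bool; true)
open import Data.Fin using (Fin; _<_)
open import Data.Fin.Properties using (_<?_; all?)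
open import Data.Vec using (Vec; lookup)
open import Data.Product using (_×_)
open import Relation.Binary.PropositionalEquality using (_≡_)
open import Relation.Nullary using (¬_; Dec; _→-dec_; _×-dec_; ¬?)
open import Data.Bool.Properties using () renaming (_≟_ to _≟ᵇ_)

-- An edge relation on the points Fin n (point i+1 of the paper is  i : Fin n).  Using Vec (not functions) makes
-- equality of edge sets extensional, so counting is meaningful.
EdgeSet : ℕ → Set
EdgeSet n = Vec (Vec Bool n) n

Edge : ∀ {n} → EdgeSet n → Fin n → Fin n → Set
Edge E i j = lookup (lookup E i) j ≡ true

Oriented : ∀ {n} → EdgeSet n → Set
Oriented {n} E = ∀ (i j : Fin n) → Edge E i j → i < j

-- no i < j < k with (i , j) , (j , k) ∈ E  (given orientation, this is: no
-- point is both a sink and a source)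
NoPath : ∀ {n} → EdgeSet n → Set
NoPath {n} E = ∀ (i j k : Fin n) → i < j → j < k → Edge E i j → ¬ Edge E j k

B1 : ∀ {n} → EdgeSet n → Set
B1 {n} E = ∀ (i j k l : Fin n) → i < j → j < k → k < l →
           Edge E i k → Edge E j l → Edge E j k

IsNetworkB1 : ∀ {n} → EdgeSet n → Set
IsNetworkB1 E = Oriented E × NoPath E × B1 E

-- decidability (used to make membership proof-irrelevant in the count)
edge? : ∀ {n} (E : EdgeSet n) i j → Dec (Edge E i j)
edge? E i j = lookup (lookup E i) j ≟ᵇ true

isNetworkB1? : ∀ {n} (E : EdgeSet n) → Dec (IsNetworkB1 E)
isNetworkB1? E =
  (all? λ i → all? λ j → edge? E i j →-dec (i <? j)) ×-dec
  ((all? λ i → all? λ j → all? λ k →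
     (i <? j) →-dec ((j <? k) →-dec (edge? E i j →-dec ¬? (edge? E j k))))) ×-dec
  (all? λ i → all? λ j → all? λ k → all? λ l →
     (i <? j) →-dec ((j <? k) →-dec ((k <? l) →-dec
       (edge? E i k →-dec (edge? E j l →-dec edge? E j k)))))

{-# OPTIONS --safe #-}
-- Remove the first point: a network on 1 + n points is a network t on the other n
-- points together with a set S of targets of the first point, all admissible in t
-- (no source, and (B1) respected).  The admissible points of the extension depend
-- only on S and the admissible set V of t: the first point is admissible iff S = ∅,
-- and k ∈ V stays admissible iff k ∈ S or S has no point beyond k.  Weight a
-- network by x ^ (number of admissible points) and let W x n be the total weight
-- on n points.  With adm(S) the number of admissible points after adding S,
-- Σ_{S ⊆ V} x ^ adm(S) = x (x + 1) ^ |V|, hence W x (1 + n) = x · W (1 + x) n,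
-- so W x n = x (x + 1) ⋯ (x + n - 1) and W 1 n = n!.  The bijections realise
-- these weights as x-colourings of the admissible points.
module Submission where

open import Defs
open import Data.Nat using (ℕ; _<_; _!)
open import Data.Fin using (Fin)
open import Data.Product using (Σ)
open import Relation.Nullary.Decidable using (True)
open import Function.Bundles using (_↔_)

open import Data.Bool using (Bool; true; false; T; not; _∧_; _∨_)
open import Data.Bool.Properties using (T-irrelevant; ¬-not)
open import Data.Empty using (⊥-elim)
open import Data.Fin as F using (zero; suc)
open import Data.Fin.Properties using (*↔×)
open import Data.Nat using (zero; suc; _*_; _+_; z<s; s<s; s<s⁻¹)
open import Data.Nat.Properties using (n≮0; *-assoc; +-suc; +-identityʳ; *-identityʳ)
open import Data.Product using (_×_; _,_; proj₁; proj₂)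
open import Data.Product.Function.Dependent.Propositional using (Σ-↔)
open import Data.Product.Function.NonDependent.Propositional using (_×-↔_)
open import Data.Product.Properties using (Σ-≡,≡→≡)
open import Data.Unit using (⊤; tt)
open import Data.Vec using (Vec; []; _∷_; lookup; map; tail)
open import Data.Vec.Properties using (lookup-map; map-id; map-∘)
open import Function.Base using (_∘_; id)
open import Function.Bundles using (Inverse; mk↔ₛ′)
open import Function.Properties.Inverse using (↔-refl; ↔-sym; ↔-trans)
open import Function.Related.Propositional using (module EquationalReasoning)
open import Function.Related.TypeIsomorphisms using (Σ-assoc)
open import Relation.Binary.PropositionalEquality
  using (_≡_; _≢_; refl; sym; trans; cong; cong₂; subst; module ≡-Reasoning)
open import Relation.Nullary using (¬_)
open import Relation.Nullary.Decidable using (toWitness; fromWitness)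

-- Triangle n lists the rows of a strictly upper triangular Boolean n × n
-- matrix; the head of S ∷ t is the out-neighbourhood of the first point.
data Triangle : ℕ → Set where
  []  : Triangle 0
  _∷_ : ∀ {n} → Vec Bool n → Triangle n → Triangle (suc n)

toEdgeSet : ∀ {n} → Triangle n → EdgeSet n
toEdgeSet []      = []
toEdgeSet (S ∷ t) = (false ∷ S) ∷ map (false ∷_) (toEdgeSet t)

fromEdgeSet : ∀ {n} → EdgeSet n → Triangle n
fromEdgeSet []               = []
fromEdgeSet ((_ ∷ S) ∷ rows) = S ∷ fromEdgeSet (map tail rows)

fromEdgeSet-toEdgeSet : ∀ {n} (t : Triangle n) → fromEdgeSet (toEdgeSet t) ≡ t
fromEdgeSet-toEdgeSet []      = refl
fromEdgeSet-toEdgeSet (S ∷ t) =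
  cong (S ∷_) (begin
    fromEdgeSet (map tail (map (false ∷_) (toEdgeSet t)))
      ≡⟨ cong fromEdgeSet (map-∘ tail (false ∷_) (toEdgeSet t)) ⟨
    fromEdgeSet (map id (toEdgeSet t))
      ≡⟨ cong fromEdgeSet (map-id (toEdgeSet t)) ⟩
    fromEdgeSet (toEdgeSet t)
      ≡⟨ fromEdgeSet-toEdgeSet t ⟩
    t ∎)
  where open ≡-Reasoning

lookup-map-tail : ∀ {m n} (rows : Vec (Vec Bool (suc n)) m) i j →
                  lookup (lookup (map tail rows) i) j ≡ lookup (lookup rows i) (suc j)
lookup-map-tail ((_ ∷ _) ∷ _) zero    j = refl
lookup-map-tail (_ ∷ rows)    (suc i) j = lookup-map-tail rows i j

map-∷-tail : ∀ {m n} (rows : Vec (Vec Bool (suc n)) m) →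
             (∀ i → lookup (lookup rows i) zero ≢ true) → map (false ∷_) (map tail rows) ≡ rows
map-∷-tail []                  _       = refl
map-∷-tail ((false ∷ r) ∷ rows) first≢ = cong ((false ∷ r) ∷_) (map-∷-tail rows (first≢ ∘ suc))
map-∷-tail ((true ∷ r) ∷ rows)  first≢ = ⊥-elim (first≢ zero refl)

toEdgeSet-fromEdgeSet : ∀ {n} (E : EdgeSet n) → Oriented E → toEdgeSet (fromEdgeSet E) ≡ E
toEdgeSet-fromEdgeSet []               _        = refl
toEdgeSet-fromEdgeSet ((x ∷ S) ∷ rows) oriented = cong₂ _∷_
  (cong (_∷ S) (sym (¬-not (n≮0 ∘ oriented zero zero))))
  (begin
    map (false ∷_) (toEdgeSet (fromEdgeSet (map tail rows)))
      ≡⟨ cong (map (false ∷_)) (toEdgeSet-fromEdgeSet (map tail rows) oriented-tail) ⟩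
    map (false ∷_) (map tail rows)
      ≡⟨ map-∷-tail rows (λ i → n≮0 ∘ oriented (suc i) zero) ⟩
    rows ∎)
  where
  open ≡-Reasoning
  oriented-tail : Oriented (map tail rows)
  oriented-tail i j e = s<s⁻¹ (oriented (suc i) (suc j) (trans (sym (lookup-map-tail rows i j)) e))

-- k may receive an edge from a new first point 0: k is no source, and (B1) for
-- (0 , k) and any (j , l) with j < k < l demands (j , k).
Admissible : ∀ {n} → EdgeSet n → Fin n → Set
Admissible E k = (∀ l → ¬ Edge E k l) × (∀ j l → j F.< k → k F.< l → Edge E j l → Edge E j k)

NoGapAt : ∀ {n} → Vec Bool n → Fin n → Set
NoGapAt S k = ∀ l → k F.< l → lookup S l ≡ true → lookup S k ≡ true

module FirstRow {n} (S : Vec Bool n) (t : Triangle n) where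

  private
    E  = toEdgeSet (S ∷ t)
    E′ = toEdgeSet t

  row-suc : ∀ i → lookup E (suc i) ≡ false ∷ lookup E′ i
  row-suc i = lookup-map i (false ∷_) E′

  edge-suc : ∀ i j → lookup (lookup E (suc i)) (suc j) ≡ lookup (lookup E′ i) j
  edge-suc i j = cong (λ r → lookup r (suc j)) (row-suc i)

  edge⁺ : ∀ {i j} → Edge E′ i j → Edge E (suc i) (suc j)
  edge⁺ {i} {j} = trans (edge-suc i j)

  edge⁻ : ∀ {i j} → Edge E (suc i) (suc j) → Edge E′ i j
  edge⁻ {i} {j} = trans (sym (edge-suc i j))

  ¬edge-to-zero : ∀ i → ¬ Edge E i zero
  ¬edge-to-zero zero    ()
  ¬edge-to-zero (suc i) e with () ← trans (sym (cong (λ r → lookup r zero) (row-suc i))) e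

  isNetworkB1-tail : IsNetworkB1 E → IsNetworkB1 E′
  isNetworkB1-tail (oriented , noPath , b1) = oriented′ , noPath′ , b1′
    where
    oriented′ : Oriented E′
    oriented′ i j e = s<s⁻¹ (oriented (suc i) (suc j) (edge⁺ e))
    noPath′ : NoPath E′
    noPath′ i j k i<j j<k e f =
      noPath (suc i) (suc j) (suc k) (s<s i<j) (s<s j<k) (edge⁺ e) (edge⁺ f)
    b1′ : B1 E′
    b1′ i j k l i<j j<k k<l e f =
      edge⁻ (b1 (suc i) (suc j) (suc k) (suc l) (s<s i<j) (s<s j<k) (s<s k<l) (edge⁺ e) (edge⁺ f))

  isNetworkB1⇒targets-admissible : IsNetworkB1 E → ∀ k → lookup S k ≡ true → Admissible E′ k
  isNetworkB1⇒targets-admissible N@(_ , noPath , b1) k e = notSource , b1-over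
    where
    notSource : ∀ l → ¬ Edge E′ k l
    notSource l f =
      noPath zero (suc k) (suc l) z<s (s<s (proj₁ (isNetworkB1-tail N) k l f)) e (edge⁺ f)
    b1-over : ∀ j l → j F.< k → k F.< l → Edge E′ j l → Edge E′ j k
    b1-over j l j<k k<l f =
      edge⁻ (b1 zero (suc j) (suc k) (suc l) z<s (s<s j<k) (s<s k<l) e (edge⁺ f))

  isNetworkB1-∷ : IsNetworkB1 E′ → (∀ k → lookup S k ≡ true → Admissible E′ k) → IsNetworkB1 E
  isNetworkB1-∷ (oriented′ , noPath′ , b1′) targets-admissible = oriented , noPath , b1
    where
    oriented : Oriented E
    oriented zero    (suc j) e = z<s
    oriented (suc i) (suc j) e = s<s (oriented′ i j (edge⁻ e))
    oriented i       zero    e = ⊥-elim (¬edge-to-zero i e)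
    noPath : NoPath E
    noPath zero    (suc j) (suc k) _   _   e f = proj₁ (targets-admissible j e) k (edge⁻ f)
    noPath (suc i) (suc j) (suc k) i<j j<k e f =
      noPath′ i j k (s<s⁻¹ i<j) (s<s⁻¹ j<k) (edge⁻ e) (edge⁻ f)
    noPath i       j       zero    _   _   _ f = ¬edge-to-zero j f
    noPath i       zero    k       _   _   e _ = ¬edge-to-zero i e
    b1 : B1 E
    b1 zero    (suc j) (suc k) (suc l) _   j<k k<l e f =
      edge⁺ (proj₂ (targets-admissible k e) j l (s<s⁻¹ j<k) (s<s⁻¹ k<l) (edge⁻ f))
    b1 (suc i) (suc j) (suc k) (suc l) i<j j<k k<l e f =
      edge⁺ (b1′ i j k l (s<s⁻¹ i<j) (s<s⁻¹ j<k) (s<s⁻¹ k<l) (edge⁻ e) (edge⁻ f))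
    b1 i       j       k       zero    _   _   _   _ f = ⊥-elim (¬edge-to-zero j f)
    b1 i       j       zero    l       _   _   _   e _ = ⊥-elim (¬edge-to-zero i e)
    b1 _       zero    _       _       ()  _   _   _ _

  admissible-zero⁺ : (∀ l → lookup S l ≢ true) → Admissible E zero
  admissible-zero⁺ empty = notSource , λ _ _ ()
    where
    notSource : ∀ l → ¬ Edge E zero l
    notSource zero    = ¬edge-to-zero zero
    notSource (suc l) = empty l

  admissible-zero⁻ : Admissible E zero → ∀ l → lookup S l ≢ true
  admissible-zero⁻ (notSource , _) l = notSource (suc l)

  admissible-suc⁺ : ∀ {k} → Admissible E′ k → NoGapAt S k → Admissible E (suc k)
  admissible-suc⁺ {k} (notSource′ , b1-over′) noGap = notSource , b1-over
    where
    notSource : ∀ l → ¬ Edge E (suc k) l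
    notSource zero    = ¬edge-to-zero (suc k)
    notSource (suc l) = notSource′ l ∘ edge⁻
    b1-over : ∀ j l → j F.< suc k → suc k F.< l → Edge E j l → Edge E j (suc k)
    b1-over zero    (suc l) _   k<l = noGap l (s<s⁻¹ k<l)
    b1-over (suc j) (suc l) j<k k<l = edge⁺ ∘ b1-over′ j l (s<s⁻¹ j<k) (s<s⁻¹ k<l) ∘ edge⁻

  admissible-suc⁻ : ∀ {k} → Admissible E (suc k) → Admissible E′ k × NoGapAt S k
  admissible-suc⁻ (notSource , b1-over) =
    ( (λ l → notSource (suc l) ∘ edge⁺)
    , (λ j l j<k k<l → edge⁻ ∘ b1-over (suc j) (suc l) (s<s j<k) (s<s k<l) ∘ edge⁺) )
    , λ l k<l → b1-over zero (suc l) z<s (s<s k<l)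

open FirstRow

none : ∀ {n} → Vec Bool n → Bool
none []      = true
none (s ∷ S) = not s ∧ none S

none-sound : ∀ {n} (S : Vec Bool n) → T (none S) → ∀ l → lookup S l ≢ true
none-sound (false ∷ S) p (suc l) = none-sound S p l

none-complete : ∀ {n} (S : Vec Bool n) → (∀ l → lookup S l ≢ true) → T (none S)
none-complete []          _     = tt
none-complete (true ∷ S)  empty = empty zero refl
none-complete (false ∷ S) empty = none-complete S (empty ∘ suc)

_⊆ᵇ_ : ∀ {n} → Vec Bool n → Vec Bool n → Bool
[]      ⊆ᵇ []          = true
(s ∷ S) ⊆ᵇ (true ∷ V)  = S ⊆ᵇ V
(s ∷ S) ⊆ᵇ (false ∷ V) = not s ∧ (S ⊆ᵇ V)

⊆ᵇ-sound : ∀ {n} (S V : Vec Bool n) → T (S ⊆ᵇ V) → ∀ k → lookup S k ≡ true → T (lookup V k)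
⊆ᵇ-sound (s ∷ S)     (true ∷ V)  _ zero    _ = tt
⊆ᵇ-sound (s ∷ S)     (true ∷ V)  p (suc k)   = ⊆ᵇ-sound S V p k
⊆ᵇ-sound (false ∷ S) (false ∷ V) p (suc k)   = ⊆ᵇ-sound S V p k

⊆ᵇ-complete : ∀ {n} (S V : Vec Bool n) → (∀ k → lookup S k ≡ true → T (lookup V k)) → T (S ⊆ᵇ V)
⊆ᵇ-complete []          []          _   = tt
⊆ᵇ-complete (s ∷ S)     (true ∷ V)  S⊆V = ⊆ᵇ-complete S V (S⊆V ∘ suc)
⊆ᵇ-complete (true ∷ S)  (false ∷ V) S⊆V = S⊆V zero refl
⊆ᵇ-complete (false ∷ S) (false ∷ V) S⊆V = ⊆ᵇ-complete S V (S⊆V ∘ suc)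

noGapAt-∷⁺ : ∀ {n s} {S : Vec Bool n} {k} → NoGapAt S k → NoGapAt (s ∷ S) (suc k)
noGapAt-∷⁺ noGap (suc l) k<l = noGap l (s<s⁻¹ k<l)

noGapAt-∷⁻ : ∀ {n s} {S : Vec Bool n} {k} → NoGapAt (s ∷ S) (suc k) → NoGapAt S k
noGapAt-∷⁻ noGap l k<l = noGap (suc l) (s<s k<l)

-- The points of V still admissible after the new first point sends edges to S.
survivors : ∀ {n} → Vec Bool n → Vec Bool n → Vec Bool n
survivors []      []      = []
survivors (s ∷ S) (v ∷ V) = v ∧ (s ∨ none S) ∷ survivors S V

survivors-sound : ∀ {n} (S V : Vec Bool n) k →
                  T (lookup (survivors S V) k) → T (lookup V k) × NoGapAt S k
survivors-sound (s ∷ S) (true ∷ V) zero    p = tt , noGap s p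
  where
  noGap : ∀ s → T (s ∨ none S) → NoGapAt (s ∷ S) zero
  noGap true  _ _       _ _ = refl
  noGap false p (suc l) _ e = ⊥-elim (none-sound S p l e)
survivors-sound (s ∷ S) (v ∷ V)    (suc k) p =
  let v , noGap = survivors-sound S V k p in v , noGapAt-∷⁺ noGap

survivors-complete : ∀ {n} (S V : Vec Bool n) k →
                     T (lookup V k) → NoGapAt S k → T (lookup (survivors S V) k)
survivors-complete (true ∷ S)  (true ∷ V) zero    _ _     = tt
survivors-complete (false ∷ S) (true ∷ V) zero    _ noGap =
  none-complete S λ l → (λ ()) ∘ noGap (suc l) z<s
survivors-complete (s ∷ S)     (v ∷ V)    (suc k) p noGap =
  survivors-complete S V k p (noGapAt-∷⁻ noGap)

admissible : ∀ {n} → Triangle n → Vec Bool n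
admissible []      = []
admissible (S ∷ t) = none S ∷ survivors S (admissible t)

admissible-sound : ∀ {n} (t : Triangle n) k →
                   T (lookup (admissible t) k) → Admissible (toEdgeSet t) k
admissible-sound (S ∷ t) zero    p = admissible-zero⁺ S t (none-sound S p)
admissible-sound (S ∷ t) (suc k) p =
  let v , noGap = survivors-sound S (admissible t) k p
  in  admissible-suc⁺ S t (admissible-sound t k v) noGap

admissible-complete : ∀ {n} (t : Triangle n) k →
                      Admissible (toEdgeSet t) k → T (lookup (admissible t) k)
admissible-complete (S ∷ t) zero    a = none-complete S (admissible-zero⁻ S t a)
admissible-complete (S ∷ t) (suc k) a =
  let a′ , noGap = admissible-suc⁻ S t a
  in  survivors-complete S (admissible t) k (admissible-complete t k a′) noGap

Network : ∀ {n} → Triangle n → Set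
Network []      = ⊤
Network (S ∷ t) = Network t × T (S ⊆ᵇ admissible t)

Network-irrelevant : ∀ {n} (t : Triangle n) (p q : Network t) → p ≡ q
Network-irrelevant []      _         _         = refl
Network-irrelevant (S ∷ t) (p , S⊆p) (q , S⊆q) =
  cong₂ _,_ (Network-irrelevant t p q) (T-irrelevant S⊆p S⊆q)

isNetworkB1⇒Network : ∀ {n} (t : Triangle n) → IsNetworkB1 (toEdgeSet t) → Network t
isNetworkB1⇒Network []      _ = tt
isNetworkB1⇒Network (S ∷ t) N =
    isNetworkB1⇒Network t (isNetworkB1-tail S t N)
  , ⊆ᵇ-complete S (admissible t)
      λ k e → admissible-complete t k (isNetworkB1⇒targets-admissible S t N k e)

Network⇒isNetworkB1 : ∀ {n} (t : Triangle n) → Network t → IsNetworkB1 (toEdgeSet t)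
Network⇒isNetworkB1 []      _         = (λ ()) , (λ ()) , (λ ())
Network⇒isNetworkB1 (S ∷ t) (N , S⊆) =
  isNetworkB1-∷ S t (Network⇒isNetworkB1 t N)
    λ k e → admissible-sound t k (⊆ᵇ-sound S (admissible t) S⊆ k e)

isNetworkB1↔Network : ∀ n → Σ (EdgeSet n) (λ E → True (isNetworkB1? E)) ↔ Σ (Triangle n) Network
isNetworkB1↔Network n = mk↔ₛ′ to from to∘from from∘to
  where
  to : Σ (EdgeSet n) (λ E → True (isNetworkB1? E)) → Σ (Triangle n) Network
  to (E , p) = fromEdgeSet E , isNetworkB1⇒Network (fromEdgeSet E)
    (subst IsNetworkB1 (sym (toEdgeSet-fromEdgeSet E (proj₁ (toWitness p)))) (toWitness p))
  from : Σ (Triangle n) Network → Σ (EdgeSet n) (λ E → True (isNetworkB1? E))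
  from (t , N) = toEdgeSet t , fromWitness (Network⇒isNetworkB1 t N)
  to∘from : ∀ y → to (from y) ≡ y
  to∘from (t , N) = Σ-≡,≡→≡ (fromEdgeSet-toEdgeSet t , Network-irrelevant t _ N)
  from∘to : ∀ x → from (to x) ≡ x
  from∘to (E , p) = Σ-≡,≡→≡ (toEdgeSet-fromEdgeSet E (proj₁ (toWitness p)) , T-irrelevant _ p)

Colour : ℕ → Bool → Set
Colour x true  = Fin x
Colour x false = ⊤

Colouring : ∀ {n} → ℕ → Vec Bool n → Set
Colouring x []      = ⊤
Colouring x (b ∷ V) = Colour x b × Colouring x V

colouring₁ : ∀ {n} (V : Vec Bool n) → Colouring 1 V
colouring₁ []          = tt
colouring₁ (true ∷ V)  = zero , colouring₁ V
colouring₁ (false ∷ V) = tt , colouring₁ V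

colouring₁-unique : ∀ {n} (V : Vec Bool n) (c : Colouring 1 V) → colouring₁ V ≡ c
colouring₁-unique []          tt         = refl
colouring₁-unique (true ∷ V)  (zero , c) = cong (zero ,_) (colouring₁-unique V c)
colouring₁-unique (false ∷ V) (tt , c)   = cong (tt ,_) (colouring₁-unique V c)

ColouredNetwork : ℕ → ℕ → Set
ColouredNetwork x n = Σ (Triangle n) λ t → Network t × Colouring x (admissible t)

colouredNetwork₁↔network : ∀ n → ColouredNetwork 1 n ↔ Σ (Triangle n) Network
colouredNetwork₁↔network n = mk↔ₛ′
  (λ (t , N , _) → t , N)
  (λ (t , N) → t , N , colouring₁ (admissible t))
  (λ _ → refl)
  (λ (t , N , c) → cong (λ c → t , N , c) (colouring₁-unique (admissible t) c))

-- In extension-∷, at the first point k of V, s says k ∈ S and b that S has no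
-- point after k; the left-hand colours are those of the new first point (needed
-- iff S has no point from k on) and of k (needed iff k survives).
colour-merge : ∀ {x} b →
  Σ Bool (λ s → Colour x (not s ∧ b) × Colour x (s ∨ b)) ↔ (Fin (suc x) × Colour x b)
colour-merge {x} b = mk↔ₛ′ (merge b) (split b) (merge∘split b) (split∘merge b)
  where
  merge : ∀ b → Σ Bool (λ s → Colour x (not s ∧ b) × Colour x (s ∨ b)) → Fin (suc x) × Colour x b
  merge true  (true  , _  , c)  = zero , c
  merge true  (false , c₀ , c₁) = suc c₁ , c₀
  merge false (false , _  , _)  = zero , tt
  merge false (true  , _  , c)  = suc c , tt
  split : ∀ b → Fin (suc x) × Colour x b → Σ Bool (λ s → Colour x (not s ∧ b) × Colour x (s ∨ b))
  split true  (zero  , c) = true  , tt , c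
  split true  (suc h , c) = false , c , h
  split false (zero  , _) = false , tt , tt
  split false (suc h , _) = true  , tt , h
  merge∘split : ∀ b y → merge b (split b y) ≡ y
  merge∘split true  (zero  , _) = refl
  merge∘split true  (suc _ , _) = refl
  merge∘split false (zero  , _) = refl
  merge∘split false (suc _ , _) = refl
  split∘merge : ∀ b y → split b (merge b y) ≡ y
  split∘merge true  (true  , _) = refl
  split∘merge true  (false , _) = refl
  split∘merge false (true  , _) = refl
  split∘merge false (false , _) = refl

Extension : ℕ → ∀ {n} → Vec Bool n → Set
Extension x {n} V =
  Σ (Vec Bool n) λ S → T (S ⊆ᵇ V) × Colour x (none S) × Colouring x (survivors S V)

extension-∷ : ∀ {x n} b (V : Vec Bool n) → Extension x (b ∷ V) ↔ (Colour (suc x) b × Extension x V)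
extension-∷ false V = mk↔ₛ′
  (λ { ((false ∷ S) , S⊆V , c₀ , _ , cs) → tt , S , S⊆V , c₀ , cs })
  (λ (_ , S , S⊆V , c₀ , cs) → (false ∷ S) , S⊆V , c₀ , tt , cs)
  (λ _ → refl)
  (λ { ((false ∷ _) , _) → refl })
extension-∷ {x} true V = mk↔ₛ′ to from to∘from from∘to
  where
  to : Extension x (true ∷ V) → Fin (suc x) × Extension x V
  to ((s ∷ S) , S⊆V , c₀ , c₁ , cs) =
    let h , c = Inverse.to (colour-merge (none S)) (s , c₀ , c₁) in h , S , S⊆V , c , cs
  from : Fin (suc x) × Extension x V → Extension x (true ∷ V)
  from (h , S , S⊆V , c , cs) =
    let s , c₀ , c₁ = Inverse.from (colour-merge (none S)) (h , c) in (s ∷ S) , S⊆V , c₀ , c₁ , cs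
  to∘from : ∀ y → to (from y) ≡ y
  to∘from (h , S , S⊆V , c , cs) =
    cong (λ (h , c) → h , S , S⊆V , c , cs)
         (Inverse.strictlyInverseˡ (colour-merge (none S)) (h , c))
  from∘to : ∀ y → from (to y) ≡ y
  from∘to ((s ∷ S) , S⊆V , c₀ , c₁ , cs) =
    cong (λ (s , c₀ , c₁) → (s ∷ S) , S⊆V , c₀ , c₁ , cs)
         (Inverse.strictlyInverseʳ (colour-merge (none S)) (s , c₀ , c₁))

extension↔ : ∀ {x n} (V : Vec Bool n) → Extension x V ↔ (Colouring (suc x) V × Fin x)
extension↔ [] = mk↔ₛ′
  (λ { ([] , _ , c , _) → tt , c })
  (λ (_ , c) → [] , tt , c , tt)
  (λ _ → refl)
  (λ { ([] , _) → refl })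
extension↔ (b ∷ V) = ↔-trans (extension-∷ b V) (↔-trans (↔-refl ×-↔ extension↔ V) (↔-sym Σ-assoc))

colouredNetwork-suc : ∀ x n → ColouredNetwork x (suc n) ↔ (ColouredNetwork (suc x) n × Fin x)
colouredNetwork-suc x n = begin
  ColouredNetwork x (suc n)
    ↔⟨ firstRow ⟩
  Σ (Triangle n) (λ t → Network t × Extension x (admissible t))
    ↔⟨ Σ-↔ ↔-refl (↔-refl ×-↔ extension↔ (admissible _)) ⟩
  Σ (Triangle n) (λ t → Network t × (Colouring (suc x) (admissible t) × Fin x))
    ↔⟨ Σ-↔ ↔-refl (↔-sym Σ-assoc) ⟩
  Σ (Triangle n) (λ t → (Network t × Colouring (suc x) (admissible t)) × Fin x)
    ↔⟨ Σ-assoc ⟨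
  (ColouredNetwork (suc x) n × Fin x) ∎
  where
  open EquationalReasoning
  firstRow : ColouredNetwork x (suc n) ↔ Σ (Triangle n) (λ t → Network t × Extension x (admissible t))
  firstRow = mk↔ₛ′
    (λ { ((S ∷ t) , (N , S⊆) , c₀ , cs) → t , N , S , S⊆ , c₀ , cs })
    (λ (t , N , S , S⊆ , c₀ , cs) → (S ∷ t) , (N , S⊆) , c₀ , cs)
    (λ _ → refl)
    (λ { ((_ ∷ _) , _) → refl })

risingFactorial : ℕ → ℕ → ℕ
risingFactorial x zero    = 1
risingFactorial x (suc n) = risingFactorial (suc x) n * x

risingFactorial-! : ∀ x n → risingFactorial (suc x) n * x ! ≡ (x + n) !
risingFactorial-! x zero    = trans (+-identityʳ (x !)) (cong _! (sym (+-identityʳ x)))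
risingFactorial-! x (suc n) = begin
  r * suc x * x !   ≡⟨ *-assoc r (suc x) (x !) ⟩
  r * suc x !       ≡⟨ risingFactorial-! (suc x) n ⟩
  (suc x + n) !     ≡⟨ cong _! (+-suc x n) ⟨
  (x + suc n) !     ∎
  where
  open ≡-Reasoning
  r : ℕ
  r = risingFactorial (suc (suc x)) n

!≡risingFactorial : ∀ n → n ! ≡ risingFactorial 1 n
!≡risingFactorial n = trans (sym (risingFactorial-! 0 n)) (*-identityʳ _)

colouredNetwork↔risingFactorial : ∀ x n → ColouredNetwork x n ↔ Fin (risingFactorial x n)
colouredNetwork↔risingFactorial x zero    =
  mk↔ₛ′ (λ _ → zero) (λ _ → [] , tt , tt) (λ { zero → refl }) (λ { ([] , _) → refl })
colouredNetwork↔risingFactorial x (suc n) = begin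
  ColouredNetwork x (suc n)                     ↔⟨ colouredNetwork-suc x n ⟩
  (ColouredNetwork (suc x) n × Fin x)           ↔⟨ colouredNetwork↔risingFactorial (suc x) n ×-↔ ↔-refl ⟩
  (Fin (risingFactorial (suc x) n) × Fin x)     ↔⟨ *↔× ⟨
  Fin (risingFactorial (suc x) n * x)           ∎
  where open EquationalReasoning

theorem2p3 : ∀ (n : ℕ) → 0 < n →
    Fin (n !) ↔ Σ (EdgeSet n) (λ E → True (isNetworkB1? E))
theorem2p3 n _ = begin
  Fin (n !)                                    ≡⟨ cong Fin (!≡risingFactorial n) ⟩
  Fin (risingFactorial 1 n)                    ↔⟨ colouredNetwork↔risingFactorial 1 n ⟨
  ColouredNetwork 1 n                          ↔⟨ colouredNetwork₁↔network n ⟩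
  Σ (Triangle n) Network                       ↔⟨ isNetworkB1↔Network n ⟨
  Σ (EdgeSet n) (λ E → True (isNetworkB1? E))  ∎
  where open EquationalReasoning
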